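{- Let $M_\preceq=(S,\Sigma,T,\mathbf{E},\mathbf{D})$ be a monotonic MDP. For every set $L\subseteq S$ that is closed for $\preceq$ and all actions $\sigma\in\Sigma$, $\tau\in T$, the set $\mathsf{Pre}_{\sigma,\tau}(L)$ is closed for $\preceq$.
   Context: An MDP is a tuple $(S,\Sigma,T,\mathbf{E},\mathbf{D})$ where $S$ is a finite set of states, $\Sigma$ and $T$ are disjoint finite sets of actions, $\mathbf{E}$ is a partial function assigning to some pairs $(s,\sigma)\in S\times\Sigma$ a total function $\mathbf{E}(s,\sigma):T\to S$, and $\mathbf{D}$ is a partial function with the same domain assigning a probability distribution $\mathbf{D}(s,\sigma)$ on $T$. $\Sigma_s$ (the actions $\sigma$ with $(s,\sigma)$ in the domain) is required nonempty for every $s$. A set $L\subseteq S$ is closed for $\preceq$ if $s\in L$, $s'\preceq s$ imply $s'\in L$. The MDP is monotonic if (1) $S$ carries a partial order $\preceq$ such that any two elements have a greatest lower bound, and (2) for all $s\preceq s'$, $\sigma\in\Sigma$, $\tau\in T$ and $t'\in S$ with $\mathbf{E}(s',\sigma)(\tau)=t'$, there is $t\in S$ with $\mathbf{E}(s,\sigma)(\tau)=t$ and $t\preceq t'$. For $L\subseteq S$, $\mathsf{Pre}_{\sigma,\tau}(L)=\{s\in S\mid \mathbf{E}(s,\sigma)(\tau)\text{ is defined and belongs to }L\}$. -}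

module Defs where

open import Level using (0ℓ)
open import Data.Nat using (ℕ)
open import Data.Fin using (Fin)
open import Data.Product using (Σ; ∃; _×_; _,_)
open import Data.Rational using (ℚ; 0ℚ; 1ℚ; _≤_; _+_)
open import Relation.Binary.PropositionalEquality using (_≡_)
open import Relation.Binary using (IsPartialOrder)
open import Relation.Unary using (Pred)

sumFin : {n : ℕ} → (Fin n → ℚ) → ℚ
sumFin {ℕ.zero} f = 0ℚ
sumFin {ℕ.suc n} f = f Fin.zero + sumFin (λ i → f (Fin.suc i))

IsDistribution : {n : ℕ} → (Fin n → ℚ) → Set
IsDistribution {n} p = (∀ i → 0ℚ ≤ p i) × sumFin p ≡ 1ℚ

-- An MDP (S, Σ, T, E, D) with S = Fin nS, Σ = Fin nA, T = Fin nT
-- (Σ and T are distinct types, hence disjoint).  Dom s σ says (s,σ) is in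
-- the domain of the partial functions E and D.
record MDP : Set₁ where
  field
    nS nA nT : ℕ
    Dom : Fin nS → Fin nA → Set
    E : (s : Fin nS) (σ : Fin nA) → Dom s σ → Fin nT → Fin nS
    D : (s : Fin nS) (σ : Fin nA) → Dom s σ → Fin nT → ℚ
    D-dist : ∀ s σ (d : Dom s σ) → IsDistribution (D s σ d)
    Σs-nonempty : ∀ s → ∃ λ σ → Dom s σ

  EIs : Fin nS → Fin nA → Fin nT → Fin nS → Set
  EIs s σ τ t = Σ (Dom s σ) λ d → E s σ d τ ≡ t

  Pre : Fin nA → Fin nT → Pred (Fin nS) 0ℓ → Pred (Fin nS) 0ℓ
  Pre σ τ L s = Σ (Dom s σ) λ d → L (E s σ d τ)

ClosedFor : {A : Set} → (_≼_ : A → A → Set) → Pred A 0ℓ → Set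
ClosedFor _≼_ L = ∀ {s s'} → L s → s' ≼ s → L s'

IsGLB : {A : Set} → (_≼_ : A → A → Set) → A → A → A → Set
IsGLB _≼_ x y m = (m ≼ x) × (m ≼ y) × (∀ z → z ≼ x → z ≼ y → z ≼ m)

record IsMonotonic (M : MDP) (_≼_ : Fin (MDP.nS M) → Fin (MDP.nS M) → Set) : Set where
  open MDP M
  field
    isPartialOrder : IsPartialOrder _≡_ _≼_
    glb : ∀ x y → ∃ λ m → IsGLB _≼_ x y m
    simulation : ∀ {s s'} σ τ t' → s ≼ s' → EIs s' σ τ t' →
                 ∃ λ t → EIs s σ τ t × t ≼ t'

module Submission where

-- Let s ∈ Pre_{σ,τ}(L), witnessed by t' = E(s,σ)(τ) ∈ L, and let
-- s' ≼ s.  The simulation condition (2) of a monotonic MDP gives a state t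
-- with E(s',σ)(τ) = t (so E(s',σ)(τ) is defined) and t ≼ t'.  Closedness of
-- L then puts t in L, hence s' ∈ Pre_{σ,τ}(L).

open import Defs
open import Data.Fin using (Fin)
open import Level using (0ℓ)
open import Relation.Unary using (Pred)
open import Data.Product using (∃; _×_; _,_)
open import Relation.Binary.PropositionalEquality using (refl; subst; sym)

module _ (M : MDP) where
  open MDP M

  Simulates : (Fin nS → Fin nS → Set) → Set
  Simulates _≼_ = ∀ {s s'} σ τ t' → s ≼ s' → EIs s' σ τ t' →
                  ∃ λ t → EIs s σ τ t × t ≼ t'

  pre-closed : (_≼_ : Fin nS → Fin nS → Set) → Simulates _≼_ →
               (L : Pred (Fin nS) 0ℓ) → ClosedFor _≼_ L →
               ∀ σ τ → ClosedFor _≼_ (Pre σ τ L)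
  pre-closed _≼_ simulates L L-closed σ τ {s} (d , t'∈L) s'≼s
    with simulates σ τ (E s σ d τ) s'≼s (d , refl)
  ... | t , (d' , E-s'≡t) , t≼t' = d' , subst L (sym E-s'≡t) (L-closed t'∈L t≼t')

lemma2 : (M : MDP) (_≼_ : Fin (MDP.nS M) → Fin (MDP.nS M) → Set) →
    IsMonotonic M _≼_ →
    (L : Pred (Fin (MDP.nS M)) 0ℓ) → ClosedFor _≼_ L →
    (σ : Fin (MDP.nA M)) (τ : Fin (MDP.nT M)) →
    ClosedFor _≼_ (MDP.Pre M σ τ L)
lemma2 M _≼_ monotonic = pre-closed M _≼_ (IsMonotonic.simulation monotonic)
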